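{- Let $\sigma$ be any permutation of length at least $2$ and let $\hat\sigma$ be obtained from $\sigma$ by interchanging its first two entries. Then for every $n$, the map $\pi\mapsto\mathrm{out}^{\sigma,\hat\sigma}(\pi)$ is a bijection from $\mathfrak S_n$ to $\mathfrak S_n$. Moreover, $$|\mathrm{Sort}_n(123,213)|=|\mathrm{Sort}_n(132,312)|=|\mathrm{Sort}_n(231,321)|=c_n=\frac{1}{n+1}\binom{2n}{n}.$$
   Context: A permutation contains a pattern $\tau$ if it has a subsequence order-isomorphic to $\tau$. For a set $T$ of patterns, a $T$-stack is a stack whose content, read top to bottom, must never contain an occurrence of a pattern of $T$; an input is processed greedily: push the next input element if this creates no forbidden occurrence in the stack, otherwise pop the top element to the output; $\mathrm{out}^T(\pi)$ (written $\mathrm{out}^{\sigma,\tau}$ for $T=\{\sigma,\tau\}$) is the resulting output. The $T$-machine is the $T$-stack followed by a $\{21\}$-stack (classical stack, greedy); $\pi$ is $T$-sortable if the output of the $T$-machine on $\pi$ is the increasing permutation. $\mathrm{Sort}_n(\sigma,\tau)$ is the set of $\{\sigma,\tau\}$-sortable permutations of length $n$. -}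

module Defs where

open import Data.Bool using (Bool; true; false; not; _∧_; _xor_; if_then_else_)
open import Data.Nat using (ℕ; zero; suc; _<ᵇ_; _*_; _/_)
open import Data.Nat.Combinatorics using (_C_)
open import Data.List using (List; []; _∷_; _++_; map; applyUpTo; length)
open import Data.Bool.ListAction using (any; all)
open import Data.List.Relation.Binary.Permutation.Propositional using (_↭_)
open import Data.List.Relation.Unary.Unique.Propositional using (Unique)
open import Data.List.Membership.Propositional using (_∈_)
open import Data.Product using (Σ; _×_)
open import Function.Bundles using (_⇔_)
open import Relation.Binary.PropositionalEquality using (_≡_)

-- Permutations are lists of natural numbers (one-line notation).
-- The increasing permutation 1 2 ... n.
idPerm : ℕ → List ℕ
idPerm n = applyUpTo suc n

IsPerm : ℕ → List ℕ → Set
IsPerm n π = π ↭ idPerm n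

subseqs : List ℕ → List (List ℕ)
subseqs []       = [] ∷ []
subseqs (x ∷ xs) = map (x ∷_) (subseqs xs) ++ subseqs xs

agree : Bool → Bool → Bool
agree a b = not (a xor b)

relAgree : ℕ → ℕ → List ℕ → List ℕ → Bool
relAgree x y []        []        = true
relAgree x y (x' ∷ xs) (y' ∷ ys) =
  agree (x <ᵇ x') (y <ᵇ y') ∧ agree (x' <ᵇ x) (y' <ᵇ y) ∧ relAgree x y xs ys
relAgree x y _ _ = false

orderIsoᵇ : List ℕ → List ℕ → Bool
orderIsoᵇ []       []       = true
orderIsoᵇ (x ∷ xs) (y ∷ ys) = relAgree x y xs ys ∧ orderIsoᵇ xs ys
orderIsoᵇ _ _ = false

containsᵇ : List ℕ → List ℕ → Bool
containsᵇ w τ = any (orderIsoᵇ τ) (subseqs w)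

avoidsᵇ : List (List ℕ) → List ℕ → Bool
avoidsᵇ T w = all (λ τ → not (containsᵇ w τ)) T

-- Arguments: set of patterns T, remaining input, stack
-- (head = top, so the list read left to right is the stack read top to bottom).
-- Push the next input if the resulting stack avoids T, otherwise pop the top;
-- when the input is exhausted, pop everything.
-- (Pushing onto an empty stack is always done: for patterns of length ≥ 2 a
-- one-element stack contains no occurrence.)
runStack : List (List ℕ) → List ℕ → List ℕ → List ℕ
runStack T []       s       = s
runStack T (x ∷ xs) []      = runStack T xs (x ∷ [])
runStack T (x ∷ xs) (y ∷ s) =
  if avoidsᵇ T (x ∷ y ∷ s)
  then runStack T xs (x ∷ y ∷ s)
  else y ∷ runStack T (x ∷ xs) s

out : List (List ℕ) → List ℕ → List ℕ
out T π = runStack T π []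

p21 : List ℕ
p21 = 2 ∷ 1 ∷ []

machine : List (List ℕ) → List ℕ → List ℕ
machine T π = out (p21 ∷ []) (out T π)

Sortable : List (List ℕ) → ℕ → List ℕ → Set
Sortable T n π = IsPerm n π × machine T π ≡ idPerm n

swap12 : List ℕ → List ℕ
swap12 (a ∷ b ∷ r) = b ∷ a ∷ r
swap12 w           = w

HasCard : (List ℕ → Set) → ℕ → Set
HasCard P c = Σ (List (List ℕ)) (λ L → Unique L × ((π : List ℕ) → (π ∈ L ⇔ P π)) × length L ≡ c)

catalan : ℕ → ℕ
catalan n = ((2 * n) C n) / suc n

p123 p213 p132 p312 p231 p321 : List ℕ
p123 = 1 ∷ 2 ∷ 3 ∷ []
p213 = 2 ∷ 1 ∷ 3 ∷ []
p132 = 1 ∷ 3 ∷ 2 ∷ []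
p312 = 3 ∷ 1 ∷ 2 ∷ []
p231 = 2 ∷ 3 ∷ 1 ∷ []
p321 = 3 ∷ 2 ∷ 1 ∷ []

-- Since σ and σ̂ differ only in their first two entries, whether two entries that can each
-- sit on a stack s can also sit on it together does not depend on their order
-- (StackingSymmetric).  This makes the {σ, σ̂}-stack reversible: run on the reversed output it
-- retraces the original run backwards, pushes becoming pops, so out (reverse (out π)) = reverse π
-- and ρ ↦ reverse (out (reverse ρ)) inverts out.  Hence π is {σ, σ̂}-sortable iff out π is sorted
-- by a classical stack.  The permutations sorted by a classical stack are enumerated by running
-- the stack backwards in time from the sorted output; their number obeys the ballot recursion,
-- which matches Pascal's rule for C(h + 2k, k) − C(h + 2k, k − 1) and gives c_n at h = 0.

module Submission where

open import Data.Bool using (true; false; T; _∧_)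
open import Data.Bool.Properties using (T-≡; T-∧)
open import Data.Empty using (⊥; ⊥-elim)
open import Data.Nat using (ℕ; zero; suc; _+_; _*_; _/_; _≤_; _<_; _<ᵇ_; s≤s)
open import Data.List using (List; []; _∷_; _++_; map; reverse; length; applyUpTo)
open import Data.List.Properties using (length-++; length-map; ∷-injective; ∷ʳ-injectiveʳ; ++-cancelʳ; ++-identityʳ; ++-assoc; reverse-++; reverse-involutive; length-applyUpTo)
open import Data.List.Membership.Propositional using (_∈_; find; lose)
open import Data.List.Membership.Propositional.Properties using (∈-map⁺; ∈-map⁻; ∈-++⁺ˡ; ∈-++⁺ʳ; ∈-++⁻)
open import Data.List.Relation.Unary.Any using (Any; here; there)
import Data.List.Relation.Unary.Any as Any
open import Data.List.Relation.Unary.Any.Properties using (any⁺; any⁻)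
open import Data.List.Relation.Binary.Sublist.Propositional using (_⊆_; []; _∷_; _∷ʳ_; ⊆-refl; ⊆-trans; minimum)
open import Data.List.Relation.Binary.Sublist.Propositional.Properties using (All-resp-⊆)
open import Data.List.Relation.Unary.All using (All; []; _∷_)
import Data.List.Relation.Unary.All as All
open import Data.List.Relation.Unary.AllPairs using (AllPairs; []; _∷_)
open import Data.List.Relation.Unary.Unique.Propositional using (Unique)
open import Data.List.Relation.Unary.Unique.Propositional.Properties using (++⁺; map⁺)
open import Data.Nat.Properties using (+-commutativeSemigroup; +-assoc; +-comm; +-cancelʳ-≡; *-comm; *-zeroʳ; *-identityˡ; *-identityʳ; *-distribˡ-+; m≤m+n; m+n∸m≡n; <ᵇ⇒<; <⇒<ᵇ; <-asym; <-trans; <-irrefl; ≤-<-trans; ≤-refl; m≤n⇒m≤1+n; n<1+n; +-identityʳ; +-suc)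
open import Algebra.Properties.CommutativeSemigroup +-commutativeSemigroup using () renaming (interchange to +-interchange)
open import Data.Nat.Combinatorics using (_C_; nCk+nC[k+1]≡[n+1]C[k+1]; nCk≡nC[n∸k]; nC1≡n)
open import Data.Nat.DivMod using (m*n/n≡m)
open import Data.Nat.Solver using (module +-*-Solver)
open +-*-Solver using (solve; _:+_; _:*_; _:=_; con)
open import Data.List.Relation.Binary.Permutation.Propositional using (_↭_; ↭-refl; ↭-reflexive; ↭-sym; ↭-trans; prep)
open import Data.List.Relation.Binary.Permutation.Propositional.Properties using (shift; ↭-reverse; ↭-length)
open import Data.Product using (Σ; ∃-syntax; _×_; _,_; proj₂)
open import Data.Sum using (_⊎_; inj₁; inj₂; [_,_]′)
open import Data.Unit using (⊤; tt)
open import Function.Bundles using (Equivalence; _⇔_; mk⇔)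
open import Relation.Nullary using (¬_)
open import Relation.Binary.PropositionalEquality

open import Defs

open Equivalence using (to; from)

Occurs : List ℕ → List ℕ → Set
Occurs τ w = ∃[ u ] u ⊆ w × T (orderIsoᵇ τ u)

occurs-⊆ : ∀ τ {u w} → u ⊆ w → Occurs τ u → Occurs τ w
occurs-⊆ τ u⊆w (v , v⊆u , iso) = v , ⊆-trans v⊆u u⊆w , iso

⊆⇒∈-subseqs : ∀ {u w} → u ⊆ w → u ∈ subseqs w
⊆⇒∈-subseqs [] = here refl
⊆⇒∈-subseqs {w = x ∷ w} (x ∷ʳ u⊆w) = ∈-++⁺ʳ (map (x ∷_) (subseqs w)) (⊆⇒∈-subseqs u⊆w)
⊆⇒∈-subseqs {w = x ∷ w} (refl ∷ u⊆w) = ∈-++⁺ˡ (∈-map⁺ (x ∷_) (⊆⇒∈-subseqs u⊆w))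

∈-subseqs⇒⊆ : ∀ {u} w → u ∈ subseqs w → u ⊆ w
∈-subseqs⇒⊆ [] (here refl) = []
∈-subseqs⇒⊆ (x ∷ w) u∈ with ∈-++⁻ (map (x ∷_) (subseqs w)) u∈
... | inj₂ u∈′ = x ∷ʳ ∈-subseqs⇒⊆ w u∈′
... | inj₁ u∈′ with ∈-map⁻ (x ∷_) u∈′
...   | v , v∈ , refl = refl ∷ ∈-subseqs⇒⊆ w v∈

containsᵇ⇒occurs : ∀ w τ → containsᵇ w τ ≡ true → Occurs τ w
containsᵇ⇒occurs w τ c with find (any⁻ (orderIsoᵇ τ) (subseqs w) (from T-≡ c))
... | u , u∈ , iso = u , ∈-subseqs⇒⊆ w u∈ , iso

occurs⇒containsᵇ : ∀ {w} τ → Occurs τ w → containsᵇ w τ ≡ true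
occurs⇒containsᵇ τ (u , u⊆w , iso) = to T-≡ (any⁺ _ (lose (⊆⇒∈-subseqs u⊆w) iso))

avoidsᵇ-false⁺ : ∀ ps {w} → Any (λ τ → Occurs τ w) ps → avoidsᵇ ps w ≡ false
avoidsᵇ-false⁺ (τ ∷ ps) {w} (here occ) with containsᵇ w τ | occurs⇒containsᵇ τ occ
... | true  | _  = refl
... | false | ()
avoidsᵇ-false⁺ (τ ∷ ps) {w} (there occ) with containsᵇ w τ
... | true  = refl
... | false = avoidsᵇ-false⁺ ps occ

avoidsᵇ-false⁻ : ∀ ps w → avoidsᵇ ps w ≡ false → Any (λ τ → Occurs τ w) ps
avoidsᵇ-false⁻ (τ ∷ ps) w e with containsᵇ w τ in c
... | true  = here (containsᵇ⇒occurs w τ c)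
... | false = there (avoidsᵇ-false⁻ ps w e)

avoidsᵇ⇒¬occurs : ∀ ps {w τ} → avoidsᵇ ps w ≡ true → τ ∈ ps → ¬ Occurs τ w
avoidsᵇ⇒¬occurs ps av τ∈ps occ with trans (sym av) (avoidsᵇ-false⁺ ps (lose τ∈ps occ))
... | ()

avoidsᵇ-false-⊆ : ∀ ps {u w} → u ⊆ w → avoidsᵇ ps u ≡ false → avoidsᵇ ps w ≡ false
avoidsᵇ-false-⊆ ps {u} u⊆w e = avoidsᵇ-false⁺ ps (Any.map (λ {τ} → occurs-⊆ τ u⊆w) (avoidsᵇ-false⁻ ps u e))

avoidsᵇ-true-⊆ : ∀ ps {u w} → u ⊆ w → avoidsᵇ ps w ≡ true → avoidsᵇ ps u ≡ true
avoidsᵇ-true-⊆ ps {u} u⊆w av with avoidsᵇ ps u in e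
... | true  = refl
... | false with trans (sym av) (avoidsᵇ-false-⊆ ps u⊆w e)
...   | ()

runStack-↭ : ∀ ps I s → runStack ps I s ↭ I ++ s
runStack-↭ ps []       s = ↭-refl
runStack-↭ ps (x ∷ I)  = go
  where
  go : ∀ s → runStack ps (x ∷ I) s ↭ x ∷ I ++ s
  go []      = ↭-trans (runStack-↭ ps I (x ∷ [])) (shift x I [])
  go (y ∷ s) with avoidsᵇ ps (x ∷ y ∷ s)
  ... | true  = ↭-trans (runStack-↭ ps I (x ∷ y ∷ s)) (shift x I (y ∷ s))
  ... | false = ↭-trans (prep y (go s)) (↭-sym (shift y (x ∷ I) s))

out-↭ : ∀ ps π → out ps π ↭ π
out-↭ ps π = subst (out ps π ↭_) (++-identityʳ π) (runStack-↭ ps π [])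

runStack-push : ∀ ps x I s → avoidsᵇ ps (x ∷ s) ≡ true → runStack ps (x ∷ I) s ≡ runStack ps I (x ∷ s)
runStack-push ps x I []      _  = refl
runStack-push ps x I (y ∷ s) av rewrite av = refl

runStack-pop : ∀ ps x I y s → avoidsᵇ ps (x ∷ y ∷ s) ≡ false → runStack ps (x ∷ I) (y ∷ s) ≡ y ∷ runStack ps (x ∷ I) s
runStack-pop ps x I y s av rewrite av = refl

-- Reversibility

StackingSymmetric : List (List ℕ) → Set
StackingSymmetric ps = ∀ x y s → avoidsᵇ ps (x ∷ s) ≡ true → avoidsᵇ ps (y ∷ s) ≡ true →
  avoidsᵇ ps (x ∷ y ∷ s) ≡ false → avoidsᵇ ps (y ∷ x ∷ s) ≡ false

reverse-∷-++ : ∀ (x : ℕ) xs r → reverse (x ∷ xs) ++ r ≡ reverse xs ++ x ∷ r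
reverse-∷-++ x xs r = trans (cong (_++ r) (reverse-++ (x ∷ []) xs)) (++-assoc (reverse xs) (x ∷ []) r)

module Reversal (ps : List (List ℕ))
                (singletons : ∀ x → avoidsᵇ ps (x ∷ []) ≡ true)
                (symmetric : StackingSymmetric ps) where

  run : List ℕ → List ℕ → List ℕ
  run = runStack ps

  run-pushAll : ∀ s t I → avoidsᵇ ps (s ++ t) ≡ true → run (reverse s ++ I) t ≡ run I (s ++ t)
  run-pushAll []      t I _  = refl
  run-pushAll (x ∷ s) t I ok-xst = begin
      run (reverse (x ∷ s) ++ I) t ≡⟨ cong (λ J → run J t) (reverse-∷-++ x s I) ⟩
      run (reverse s ++ x ∷ I) t   ≡⟨ run-pushAll s t (x ∷ I) (avoidsᵇ-true-⊆ ps (x ∷ʳ ⊆-refl {x = s ++ t}) ok-xst) ⟩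
      run (x ∷ I) (s ++ t)         ≡⟨ runStack-push ps x I (s ++ t) ok-xst ⟩
      run I (x ∷ s ++ t)           ∎
    where open ≡-Reasoning

  BlocksAfterNextPush : List ℕ → ℕ → List ℕ → Set
  BlocksAfterNextPush []      y s = ⊥
  BlocksAfterNextPush (z ∷ _) y s = avoidsᵇ ps (z ∷ y ∷ s) ≡ false

  Blocked : List ℕ → List ℕ → List ℕ → Set
  Blocked I s []      = ⊤
  Blocked I s (y ∷ Q) = avoidsᵇ ps (y ∷ s) ≡ false ⊎ BlocksAfterNextPush I y s

  cannot-stack-over : ∀ x s y → avoidsᵇ ps (x ∷ s) ≡ true →
                      avoidsᵇ ps (y ∷ s) ≡ false ⊎ avoidsᵇ ps (x ∷ y ∷ s) ≡ false →
                      avoidsᵇ ps (y ∷ x ∷ s) ≡ false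
  cannot-stack-over x s y _ (inj₁ bad-ys) = avoidsᵇ-false-⊆ ps (refl {x = y} ∷ x ∷ʳ ⊆-refl {x = s}) bad-ys
  cannot-stack-over x s y ok-xs (inj₂ bad-xys) with avoidsᵇ ps (y ∷ s) in y-on-s
  ... | false = avoidsᵇ-false-⊆ ps (refl {x = y} ∷ x ∷ʳ ⊆-refl {x = s}) y-on-s
  ... | true  = symmetric x y s ok-xs y-on-s bad-xys

  blocked-after-push : ∀ x {I} s Q → avoidsᵇ ps (x ∷ s) ≡ true → Blocked (x ∷ I) s Q → Blocked I (x ∷ s) Q
  blocked-after-push x s []      _   _ = tt
  blocked-after-push x s (y ∷ Q) ok-xs b = inj₁ (cannot-stack-over x s y ok-xs b)

  run-popPushed : ∀ x {I} s Q → avoidsᵇ ps (x ∷ s) ≡ true → Blocked (x ∷ I) s Q → run Q (x ∷ s) ≡ x ∷ run Q s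
  run-popPushed x s []      _   _ = refl
  run-popPushed x s (y ∷ Q) ok-xs b = runStack-pop ps y Q x s (cannot-stack-over x s y ok-xs b)

  -- Reading the reversed remaining output of configuration (I, s), the stack retraces the
  -- run from (I, s) backwards, pushes becoming pops: it outputs reverse I and ends with
  -- stack s.  Blocked I s Q says that the entry output just before (the head of Q) could
  -- not sit on s, so that the retraced run goes on popping.
  replay : ∀ I s Q → avoidsᵇ ps s ≡ true → Blocked I s Q →
           run (reverse (run I s) ++ Q) [] ≡ reverse I ++ run Q s
  replay [] s Q ok-s _ = begin
      run (reverse s ++ Q) [] ≡⟨ run-pushAll s [] Q (subst (λ w → avoidsᵇ ps w ≡ true) (sym (++-identityʳ s)) ok-s) ⟩
      run Q (s ++ [])         ≡⟨ cong (run Q) (++-identityʳ s) ⟩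
      run Q s                 ∎
    where open ≡-Reasoning
  replay (x ∷ I) = replay-∷
    where
    open ≡-Reasoning

    replay-push : ∀ s Q → avoidsᵇ ps (x ∷ s) ≡ true → Blocked (x ∷ I) s Q →
                  run (reverse (run I (x ∷ s)) ++ Q) [] ≡ reverse (x ∷ I) ++ run Q s
    replay-push s Q ok-xs b = begin
        run (reverse (run I (x ∷ s)) ++ Q) [] ≡⟨ replay I (x ∷ s) Q ok-xs (blocked-after-push x s Q ok-xs b) ⟩
        reverse I ++ run Q (x ∷ s)            ≡⟨ cong (reverse I ++_) (run-popPushed x s Q ok-xs b) ⟩
        reverse I ++ x ∷ run Q s              ≡⟨ reverse-∷-++ x I (run Q s) ⟨
        reverse (x ∷ I) ++ run Q s            ∎

    replay-∷ : ∀ s Q → avoidsᵇ ps s ≡ true → Blocked (x ∷ I) s Q →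
               run (reverse (run (x ∷ I) s) ++ Q) [] ≡ reverse (x ∷ I) ++ run Q s
    replay-∷ []      Q _  b = replay-push [] Q (singletons x) b
    replay-∷ (t ∷ s) Q ok-s b with avoidsᵇ ps (x ∷ t ∷ s) in x-on-ts
    ... | true  = replay-push (t ∷ s) Q x-on-ts b
    ... | false = begin
        run (reverse (t ∷ run (x ∷ I) s) ++ Q) [] ≡⟨ cong (λ J → run J []) (reverse-∷-++ t (run (x ∷ I) s) Q) ⟩
        run (reverse (run (x ∷ I) s) ++ t ∷ Q) [] ≡⟨ replay-∷ s (t ∷ Q) (avoidsᵇ-true-⊆ ps (t ∷ʳ ⊆-refl {x = s}) ok-s) (inj₂ x-on-ts) ⟩
        reverse (x ∷ I) ++ run (t ∷ Q) s          ≡⟨ cong (reverse (x ∷ I) ++_) (runStack-push ps t Q s ok-s) ⟩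
        reverse (x ∷ I) ++ run Q (t ∷ s)          ∎

  out-reverse-out : ∀ π → out ps (reverse (out ps π)) ≡ reverse π
  out-reverse-out π = begin
      run (reverse (run π [])) []      ≡⟨ cong (λ J → run J []) (++-identityʳ (reverse (run π []))) ⟨
      run (reverse (run π []) ++ []) [] ≡⟨ replay π [] [] (avoidsᵇ-true-⊆ ps (minimum (0 ∷ [])) (singletons 0)) tt ⟩
      reverse π ++ []                   ≡⟨ ++-identityʳ (reverse π) ⟩
      reverse π                         ∎
    where open ≡-Reasoning

  out⁻¹ : List ℕ → List ℕ
  out⁻¹ ρ = reverse (out ps (reverse ρ))

  out-out⁻¹ : ∀ ρ → out ps (out⁻¹ ρ) ≡ ρ
  out-out⁻¹ ρ = trans (out-reverse-out (reverse ρ)) (reverse-involutive ρ)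

  out⁻¹-out : ∀ π → out⁻¹ (out ps π) ≡ π
  out⁻¹-out π = trans (cong reverse (out-reverse-out π)) (reverse-involutive π)

  out⁻¹-↭ : ∀ ρ → out⁻¹ ρ ↭ ρ
  out⁻¹-↭ ρ = ↭-trans (↭-reverse _) (↭-trans (out-↭ ps (reverse ρ)) (↭-reverse ρ))

withSwap : List ℕ → List (List ℕ)
withSwap σ = σ ∷ swap12 σ ∷ []

∧-swap-heads : ∀ p q r₁ r₂ o → T ((p ∧ (q ∧ r₁)) ∧ (r₂ ∧ o)) → T ((q ∧ (p ∧ r₂)) ∧ (r₁ ∧ o))
∧-swap-heads true true true true true _ = tt

orderIsoᵇ-swap12 : ∀ τ x y u → T (orderIsoᵇ τ (x ∷ y ∷ u)) → T (orderIsoᵇ (swap12 τ) (y ∷ x ∷ u))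
orderIsoᵇ-swap12 (a ∷ b ∷ τ) x y u =
  ∧-swap-heads (agree (a <ᵇ b) (x <ᵇ y)) (agree (b <ᵇ a) (y <ᵇ x)) (relAgree a x τ u) (relAgree b y τ u) (orderIsoᵇ τ u)

swap12-∈-withSwap : ∀ a b r {τ} → τ ∈ withSwap (a ∷ b ∷ r) → swap12 τ ∈ withSwap (a ∷ b ∷ r)
swap12-∈-withSwap a b r (here refl)         = there (here refl)
swap12-∈-withSwap a b r (there (here refl)) = here refl

withSwap-stackingSymmetric : ∀ a b r → StackingSymmetric (withSwap (a ∷ b ∷ r))
withSwap-stackingSymmetric a b r x y s ok-xs ok-ys bad-xys
  with find (avoidsᵇ-false⁻ (withSwap (a ∷ b ∷ r)) (x ∷ y ∷ s) bad-xys)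
... | τ , τ∈ , u , y ∷ʳ u⊆s , iso = ⊥-elim (avoidsᵇ⇒¬occurs _ ok-ys τ∈ (u , u⊆s , iso))
... | τ , τ∈ , x ∷ u , refl ∷ y ∷ʳ u⊆s , iso = ⊥-elim (avoidsᵇ⇒¬occurs _ ok-xs τ∈ (x ∷ u , refl ∷ u⊆s , iso))
... | τ , τ∈ , x ∷ y ∷ u , refl ∷ refl ∷ u⊆s , iso =
  avoidsᵇ-false⁺ _ (lose (swap12-∈-withSwap a b r τ∈) (y ∷ x ∷ u , refl ∷ refl ∷ u⊆s , orderIsoᵇ-swap12 τ x y u iso))

module WithSwap (a b : ℕ) (r : List ℕ) =
  Reversal (withSwap (a ∷ b ∷ r)) (λ _ → refl) (withSwap-stackingSymmetric a b r)

BijectiveOnPerms : ℕ → (List ℕ → List ℕ) → Set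
BijectiveOnPerms n f =
  ((π : List ℕ) → IsPerm n π → IsPerm n (f π))
  × ((π π′ : List ℕ) → IsPerm n π → IsPerm n π′ → f π ≡ f π′ → π ≡ π′)
  × ((ρ : List ℕ) → IsPerm n ρ → Σ (List ℕ) (λ π → IsPerm n π × f π ≡ ρ))

out-withSwap-bijective : ∀ σ → 2 ≤ length σ → ∀ n → BijectiveOnPerms n (out (withSwap σ))
out-withSwap-bijective (a ∷ b ∷ r) _ n =
    (λ π π-perm → ↭-trans (out-↭ _ π) π-perm)
  , (λ π π′ _ _ eq → trans (sym (out⁻¹-out π)) (trans (cong out⁻¹ eq) (out⁻¹-out π′)))
  , (λ ρ ρ-perm → out⁻¹ ρ , ↭-trans (out⁻¹-↭ ρ) ρ-perm , out-out⁻¹ ρ)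
  where open WithSwap a b r
out-withSwap-bijective (a ∷ []) (s≤s ()) n

length-perm : ∀ {k σ} → IsPerm k σ → length σ ≡ k
length-perm {k} σ-perm = trans (↭-length σ-perm) (length-applyUpTo suc k)

-- The classical stack and its sortable permutations

AllPairs-resp-⊆ : ∀ {R : ℕ → ℕ → Set} {xs ys} → xs ⊆ ys → AllPairs R ys → AllPairs R xs
AllPairs-resp-⊆ []           []         = []
AllPairs-resp-⊆ (y ∷ʳ xs⊆ys) (_ ∷ ys↑)  = AllPairs-resp-⊆ xs⊆ys ys↑
AllPairs-resp-⊆ (refl ∷ xs⊆ys) (y≺ ∷ ys↑) = All-resp-⊆ xs⊆ys y≺ ∷ AllPairs-resp-⊆ xs⊆ys ys↑

orderIsoᵇ-21⁻ : ∀ u → T (orderIsoᵇ p21 u) → ∃[ a ] ∃[ b ] u ≡ a ∷ b ∷ [] × b < a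
orderIsoᵇ-21⁻ (a ∷ b ∷ []) iso with b <ᵇ a in b<a | a <ᵇ b
... | true | false = a , b , refl , <ᵇ⇒< b a (subst T (sym b<a) tt)
orderIsoᵇ-21⁻ (a ∷ b ∷ c ∷ u) iso = ⊥-elim (proj₂ (to T-∧ iso))

orderIsoᵇ-21⁺ : ∀ {y j} → j < y → T (orderIsoᵇ p21 (y ∷ j ∷ []))
orderIsoᵇ-21⁺ {y} {j} j<y with y <ᵇ j in y<j | j <ᵇ y | <⇒<ᵇ j<y
... | false | true | _ = tt
... | true  | _    | _ = ⊥-elim (<-asym j<y (<ᵇ⇒< y j (subst T (sym y<j) tt)))

run₂₁ : List ℕ → List ℕ → List ℕ
run₂₁ = runStack (p21 ∷ [])

increasing⇒avoids21 : ∀ {w} → AllPairs _<_ w → avoidsᵇ (p21 ∷ []) w ≡ true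
increasing⇒avoids21 {w} w↑ with avoidsᵇ (p21 ∷ []) w in e
... | true  = refl
... | false with avoidsᵇ-false⁻ (p21 ∷ []) w e
...   | here (u , u⊆w , iso) with orderIsoᵇ-21⁻ u iso
...     | a , b , refl , b<a with AllPairs-resp-⊆ u⊆w w↑
...       | (a<b ∷ []) ∷ _ = ⊥-elim (<-asym a<b b<a)

run₂₁-push : ∀ x σ S → AllPairs _<_ (x ∷ S) → run₂₁ (x ∷ σ) S ≡ run₂₁ σ (x ∷ S)
run₂₁-push x σ S xS↑ = runStack-push (p21 ∷ []) x σ S (increasing⇒avoids21 xS↑)

run₂₁-pop : ∀ j σ S → All (j <_) σ → run₂₁ σ (j ∷ S) ≡ j ∷ run₂₁ σ S
run₂₁-pop j []      S _           = refl
run₂₁-pop j (y ∷ σ) S (j<y ∷ _)  = runStack-pop (p21 ∷ []) y σ j S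
  (avoidsᵇ-false⁺ (p21 ∷ []) (here ((y ∷ j ∷ []) , (refl ∷ refl ∷ minimum S) , orderIsoᵇ-21⁺ j<y)))

range : ℕ → ℕ → List ℕ
range a zero    = []
range a (suc m) = a ∷ range (suc a) m

range-∷ʳ : ∀ a m → range a m ++ (a + m) ∷ [] ≡ range a (suc m)
range-∷ʳ a zero    = cong (_∷ []) (+-identityʳ a)
range-∷ʳ a (suc m) = cong (a ∷_) (trans (cong (λ b → range (suc a) m ++ b ∷ []) (+-suc a m)) (range-∷ʳ (suc a) m))

range-++-∷ : ∀ k X → range 1 k ++ suc k ∷ X ≡ range 1 (suc k) ++ X
range-++-∷ k X = trans (sym (++-assoc (range 1 k) (suc k ∷ []) X)) (cong (_++ X) (range-∷ʳ 1 k))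

applyUpTo≡range : ∀ (f : ℕ → ℕ) a n → (∀ i → f i ≡ a + i) → applyUpTo f n ≡ range a n
applyUpTo≡range f a zero    _ = refl
applyUpTo≡range f a (suc n) f≗a+ = cong₂ _∷_ (trans (f≗a+ 0) (+-identityʳ a))
  (applyUpTo≡range (λ i → f (suc i)) (suc a) n (λ i → trans (f≗a+ (suc i)) (+-suc a i)))

idPerm≡range : ∀ n → idPerm n ≡ range 1 n
idPerm≡range n = applyUpTo≡range suc 1 n (λ _ → refl)

-- π ∈ inputsReaching j S σ: the classical stack, run on π, outputs 1 … j and then sits
-- at remaining input σ with stack S (for S increasing and all entries of S and σ above j).
-- The list is built backwards in time: the move before that moment either popped j or
-- pushed the top of S.
inputsReaching : ℕ → List ℕ → List ℕ → List (List ℕ)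
inputsReaching zero    []      σ = σ ∷ []
inputsReaching zero    (x ∷ S) σ = inputsReaching zero S (x ∷ σ)
inputsReaching (suc k) []      σ = inputsReaching k (suc k ∷ []) σ
inputsReaching (suc k) (x ∷ S) σ = inputsReaching k (suc k ∷ x ∷ S) σ ++ inputsReaching (suc k) S (x ∷ σ)

∈-inputsReaching-pop : ∀ k S σ {π} → π ∈ inputsReaching k (suc k ∷ S) σ → π ∈ inputsReaching (suc k) S σ
∈-inputsReaching-pop k []      σ π∈ = π∈
∈-inputsReaching-pop k (x ∷ S) σ π∈ = ∈-++⁺ˡ π∈

∈-inputsReaching-push : ∀ j x S σ {π} → π ∈ inputsReaching j S (x ∷ σ) → π ∈ inputsReaching j (x ∷ S) σ
∈-inputsReaching-push zero    x S σ π∈ = π∈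
∈-inputsReaching-push (suc k) x S σ π∈ = ∈-++⁺ʳ (inputsReaching k (suc k ∷ x ∷ S) σ) π∈

All-<-pred : ∀ {k w} → All (suc k <_) w → All (k <_) w
All-<-pred = All.map (<-trans (n<1+n _))

run₂₁-pop-next : ∀ k S σ → All (suc k <_) σ → range 1 k ++ run₂₁ σ (suc k ∷ S) ≡ range 1 (suc k) ++ run₂₁ σ S
run₂₁-pop-next k S σ k<σ = begin
    range 1 k ++ run₂₁ σ (suc k ∷ S) ≡⟨ cong (range 1 k ++_) (run₂₁-pop (suc k) σ S k<σ) ⟩
    range 1 k ++ suc k ∷ run₂₁ σ S   ≡⟨ range-++-∷ k (run₂₁ σ S) ⟩
    range 1 (suc k) ++ run₂₁ σ S     ∎
  where open ≡-Reasoning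

inputsReaching-sound : ∀ j S σ {π} → π ∈ inputsReaching j S σ →
                       AllPairs _<_ S → All (j <_) S → All (j <_) σ →
                       run₂₁ π [] ≡ range 1 j ++ run₂₁ σ S
inputsReaching-sound zero [] σ (here refl) _ _ _ = refl
inputsReaching-sound zero (x ∷ S) σ π∈ xS↑@(_ ∷ S↑) (0<x ∷ 0<S) 0<σ =
  trans (inputsReaching-sound zero S (x ∷ σ) π∈ S↑ 0<S (0<x ∷ 0<σ)) (run₂₁-push x σ S xS↑)
inputsReaching-sound (suc k) [] σ π∈ [] [] k<σ =
  trans (inputsReaching-sound k (suc k ∷ []) σ π∈ ([] ∷ []) (n<1+n k ∷ []) (All-<-pred k<σ))
        (run₂₁-pop-next k [] σ k<σ)
inputsReaching-sound (suc k) (x ∷ S) σ π∈ xS↑@(_ ∷ S↑) k<xS@(k<x ∷ k<S) k<σ =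
  [ (λ π∈pop → trans (inputsReaching-sound k (suc k ∷ x ∷ S) σ π∈pop (k<xS ∷ xS↑) (n<1+n k ∷ All-<-pred k<xS) (All-<-pred k<σ))
                     (run₂₁-pop-next k (x ∷ S) σ k<σ))
  , (λ π∈push → trans (inputsReaching-sound (suc k) S (x ∷ σ) π∈push S↑ k<S (k<x ∷ k<σ))
                      (cong (range 1 (suc k) ++_) (run₂₁-push x σ S xS↑)))
  ]′ (∈-++⁻ (inputsReaching k (suc k ∷ x ∷ S) σ) π∈)

inputsReaching-complete : ∀ σ S k m {π} → run₂₁ σ S ≡ range (suc k) m →
                          π ∈ inputsReaching k S σ → π ∈ inputsReaching (k + m) [] []
inputsReaching-complete-pop : ∀ σ S k m {π} → run₂₁ σ S ≡ range (suc (suc k)) m →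
                              π ∈ inputsReaching k (suc k ∷ S) σ → π ∈ inputsReaching (k + suc m) [] []

inputsReaching-complete [] [] k zero _ π∈ =
  subst (λ j → _ ∈ inputsReaching j [] []) (sym (+-identityʳ k)) π∈
inputsReaching-complete [] (y ∷ S) k (suc m) refl π∈ = inputsReaching-complete-pop [] S k m refl π∈
inputsReaching-complete (x ∷ σ) [] k m run≡ π∈ =
  inputsReaching-complete σ (x ∷ []) k m run≡ (∈-inputsReaching-push k x [] σ π∈)
inputsReaching-complete (x ∷ σ) (y ∷ S) k m run≡ π∈ with avoidsᵇ (p21 ∷ []) (x ∷ y ∷ S)
... | true = inputsReaching-complete σ (x ∷ y ∷ S) k m run≡ (∈-inputsReaching-push k x (y ∷ S) σ π∈)
inputsReaching-complete (x ∷ σ) (y ∷ S) k (suc m) run≡ π∈ | false with ∷-injective run≡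
... | refl , run≡′ = inputsReaching-complete-pop (x ∷ σ) S k m run≡′ π∈

inputsReaching-complete-pop σ S k m {π} run≡ π∈ =
  subst (λ j → π ∈ inputsReaching j [] []) (sym (+-suc k m))
        (inputsReaching-complete σ S (suc k) m run≡ (∈-inputsReaching-pop k S σ π∈))

suffix-∷ : ∀ {π : List ℕ} (x : ℕ) σ → ∃[ ρ ] π ≡ ρ ++ x ∷ σ → ∃[ ρ ] π ≡ ρ ++ σ
suffix-∷ x σ (ρ , refl) = ρ ++ x ∷ [] , sym (++-assoc ρ (x ∷ []) σ)

inputsReaching-suffix : ∀ j S σ {π} → π ∈ inputsReaching j S σ → ∃[ ρ ] π ≡ ρ ++ σ
inputsReaching-suffix zero    []      σ (here refl) = [] , refl
inputsReaching-suffix zero    (x ∷ S) σ π∈ = suffix-∷ x σ (inputsReaching-suffix zero S (x ∷ σ) π∈)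
inputsReaching-suffix (suc k) []      σ π∈ = inputsReaching-suffix k (suc k ∷ []) σ π∈
inputsReaching-suffix (suc k) (x ∷ S) σ π∈ =
  [ inputsReaching-suffix k (suc k ∷ x ∷ S) σ
  , (λ π∈push → suffix-∷ x σ (inputsReaching-suffix (suc k) S (x ∷ σ) π∈push))
  ]′ (∈-++⁻ (inputsReaching k (suc k ∷ x ∷ S) σ) π∈)

-- The entry of π just before σ is the last one pushed: by now it is either output or the top of the stack.
inputsReaching-entryBefore : ∀ k S σ {π} → π ∈ inputsReaching k (suc k ∷ S) σ →
                             ∃[ ρ ] ∃[ z ] π ≡ ρ ++ z ∷ σ × z ≤ suc k
inputsReaching-entryBefore zero S σ π∈ =
  let ρ , π≡ = inputsReaching-suffix zero S (1 ∷ σ) π∈ in ρ , 1 , π≡ , ≤-refl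
inputsReaching-entryBefore (suc k) S σ π∈ =
  [ (λ π∈pop → let ρ , z , π≡ , z≤ = inputsReaching-entryBefore k (suc (suc k) ∷ S) σ π∈pop
               in ρ , z , π≡ , m≤n⇒m≤1+n z≤)
  , (λ π∈push → let ρ , π≡ = inputsReaching-suffix (suc k) S (suc (suc k) ∷ σ) π∈push
                in ρ , suc (suc k) , π≡ , ≤-refl)
  ]′ (∈-++⁻ (inputsReaching k (suc k ∷ suc (suc k) ∷ S) σ) π∈)

++-∷-cancelʳ : ∀ ρ ρ′ {z x : ℕ} σ → ρ ++ z ∷ σ ≡ ρ′ ++ x ∷ σ → z ≡ x
++-∷-cancelʳ ρ ρ′ {z} {x} σ eq = ∷ʳ-injectiveʳ ρ ρ′ (++-cancelʳ σ (ρ ++ z ∷ []) (ρ′ ++ x ∷ [])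
  (trans (++-assoc ρ (z ∷ []) σ) (trans eq (sym (++-assoc ρ′ (x ∷ []) σ)))))

inputsReaching-unique : ∀ j S σ → All (j <_) S → Unique (inputsReaching j S σ)
inputsReaching-unique zero    []      σ _ = [] ∷ []
inputsReaching-unique zero    (x ∷ S) σ (_ ∷ 0<S) = inputsReaching-unique zero S (x ∷ σ) 0<S
inputsReaching-unique (suc k) []      σ _ = inputsReaching-unique k (suc k ∷ []) σ (n<1+n k ∷ [])
inputsReaching-unique (suc k) (x ∷ S) σ k<xS@(k<x ∷ k<S) =
  ++⁺ (inputsReaching-unique k (suc k ∷ x ∷ S) σ (n<1+n k ∷ All-<-pred k<xS))
      (inputsReaching-unique (suc k) S (x ∷ σ) k<S)
      popped≠pushed
  where
  popped≠pushed : ∀ {π} → ¬ (π ∈ inputsReaching k (suc k ∷ x ∷ S) σ × π ∈ inputsReaching (suc k) S (x ∷ σ))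
  popped≠pushed (π∈pop , π∈push) with inputsReaching-entryBefore k (x ∷ S) σ π∈pop
                                    | inputsReaching-suffix (suc k) S (x ∷ σ) π∈push
  ... | ρ , z , π≡ , z≤ | ρ′ , π≡′ with ++-∷-cancelʳ ρ ρ′ σ (trans (sym π≡) π≡′)
  ... | refl = <-irrefl refl (≤-<-trans z≤ k<x)

ballot : ℕ → ℕ → ℕ
ballot zero    h       = 1
ballot (suc k) zero    = ballot k 1
ballot (suc k) (suc h) = ballot k (suc (suc h)) + ballot (suc k) h

length-inputsReaching : ∀ j S σ → length (inputsReaching j S σ) ≡ ballot j (length S)
length-inputsReaching zero    []      σ = refl
length-inputsReaching zero    (x ∷ S) σ = length-inputsReaching zero S (x ∷ σ)
length-inputsReaching (suc k) []      σ = length-inputsReaching k (suc k ∷ []) σ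
length-inputsReaching (suc k) (x ∷ S) σ = trans (length-++ (inputsReaching k (suc k ∷ x ∷ S) σ))
  (cong₂ _+_ (length-inputsReaching k (suc k ∷ x ∷ S) σ) (length-inputsReaching (suc k) S (x ∷ σ)))

-- Ballot and Catalan numbers

choosePrev : ℕ → ℕ → ℕ
choosePrev N zero    = 0
choosePrev N (suc k) = N C k

pascal : ∀ N k → suc N C suc k ≡ N C k + N C suc k
pascal N k = sym (nCk+nC[k+1]≡[n+1]C[k+1] N k)

pascal-choosePrev : ∀ N k → suc N C k ≡ choosePrev N k + N C k
pascal-choosePrev N zero    = refl
pascal-choosePrev N (suc k) = pascal N k

C-symmetric : ∀ k j {N} → k + j ≡ N → N C k ≡ N C j
C-symmetric k j refl = trans (nCk≡nC[n∸k] (m≤m+n k j)) (cong ((k + j) C_) (m+n∸m≡n k j))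

k*2≡k+k : ∀ k → k * 2 ≡ k + k
k*2≡k+k k = trans (*-comm k 2) (cong (k +_) (+-identityʳ k))

ballot-difference : ∀ k h → ballot k h + choosePrev (h + k * 2) k ≡ (h + k * 2) C k
ballot-difference zero    h       = refl
ballot-difference (suc k) zero    = begin
    ballot k 1 + suc M C k             ≡⟨ cong (ballot k 1 +_) (pascal-choosePrev M k) ⟩
    ballot k 1 + (choosePrev M k + M C k) ≡⟨ +-assoc (ballot k 1) (choosePrev M k) (M C k) ⟨
    ballot k 1 + choosePrev M k + M C k ≡⟨ cong (_+ M C k) (ballot-difference k 1) ⟩
    M C k + M C k                      ≡⟨ cong (M C k +_) (C-symmetric k (suc k) (trans (+-suc k k) (cong suc (sym (k*2≡k+k k))))) ⟩
    M C k + M C suc k                  ≡⟨ pascal M k ⟨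
    suc M C suc k                      ∎
  where
  open ≡-Reasoning
  M = suc (k * 2)
ballot-difference (suc k) (suc h) = begin
    (ballot k (suc (suc h)) + ballot (suc k) h) + suc B C k
      ≡⟨ cong (ballot k (suc (suc h)) + ballot (suc k) h +_) (pascal-choosePrev B k) ⟩
    (ballot k (suc (suc h)) + ballot (suc k) h) + (choosePrev B k + B C k)
      ≡⟨ +-interchange (ballot k (suc (suc h))) (ballot (suc k) h) (choosePrev B k) (B C k) ⟩
    (ballot k (suc (suc h)) + choosePrev B k) + (ballot (suc k) h + B C k)
      ≡⟨ cong₂ _+_ (subst (λ N → ballot k (suc (suc h)) + choosePrev N k ≡ N C k) 2+h+k*2≡B (ballot-difference k (suc (suc h))))
                   (ballot-difference (suc k) h) ⟩
    B C k + B C suc k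
      ≡⟨ pascal B k ⟨
    suc B C suc k ∎
  where
  open ≡-Reasoning
  B = h + suc k * 2
  2+h+k*2≡B : suc (suc h) + k * 2 ≡ B
  2+h+k*2≡B = sym (trans (+-suc h (suc (k * 2))) (cong suc (+-suc h (k * 2))))

C-absorb : ∀ n k → suc k * (suc n C suc k) ≡ suc n * (n C k)
C-absorb zero    zero    = refl
C-absorb zero    (suc k) = *-zeroʳ (suc (suc k))
C-absorb (suc n) zero    = trans (*-identityˡ _) (trans (nC1≡n (suc (suc n))) (sym (*-identityʳ _)))
C-absorb (suc n) (suc k) = begin
    suc (suc k) * (suc (suc n) C suc (suc k)) ≡⟨ cong (suc (suc k) *_) (pascal (suc n) (suc k)) ⟩
    suc (suc k) * (X + Y)                    ≡⟨ solve 3 (λ k X Y → (con 2 :+ k) :* (X :+ Y) := X :+ (con 1 :+ k) :* X :+ (con 2 :+ k) :* Y) refl k X Y ⟩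
    X + suc k * X + suc (suc k) * Y          ≡⟨ cong₂ (λ u v → X + u + v) (C-absorb n k) (C-absorb n (suc k)) ⟩
    X + suc n * P + suc n * Q                ≡⟨ solve 4 (λ n X P Q → X :+ (con 1 :+ n) :* P :+ (con 1 :+ n) :* Q := X :+ (con 1 :+ n) :* (P :+ Q)) refl n X P Q ⟩
    X + suc n * (P + Q)                      ≡⟨ cong (λ z → X + suc n * z) (pascal n k) ⟨
    suc (suc n) * X                          ∎
  where
  open ≡-Reasoning
  X = suc n C suc k
  Y = suc n C suc (suc k)
  P = n C k
  Q = n C suc k

choosePrev-central-ratio : ∀ n → suc n * choosePrev (n * 2) n ≡ n * ((n * 2) C n)
choosePrev-central-ratio zero    = refl
choosePrev-central-ratio (suc m) = begin
    suc (suc m) * (suc A C m)         ≡⟨ cong (suc (suc m) *_) (C-symmetric m (suc (suc m)) m+[m+2]≡N) ⟩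
    suc (suc m) * (suc A C suc (suc m)) ≡⟨ C-absorb A (suc m) ⟩
    suc A * (A C suc m)                ≡⟨ cong (suc A *_) (C-symmetric (suc m) m (trans (+-comm (suc m) m) m+[m+1]≡A)) ⟩
    suc A * (A C m)                    ≡⟨ C-absorb A m ⟨
    suc m * (suc A C suc m)            ∎
  where
  open ≡-Reasoning
  A = suc (m * 2)
  m+[m+1]≡A : m + suc m ≡ A
  m+[m+1]≡A = trans (+-suc m m) (cong suc (sym (k*2≡k+k m)))
  m+[m+2]≡N : m + suc (suc m) ≡ suc A
  m+[m+2]≡N = trans (+-suc m (suc m)) (cong suc m+[m+1]≡A)

ballot≡catalan : ∀ n → ballot n 0 ≡ catalan n
ballot≡catalan n = begin
    ballot n 0              ≡⟨ m*n/n≡m (ballot n 0) (suc n) ⟨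
    ballot n 0 * suc n / suc n ≡⟨ cong (_/ suc n) (trans (*-comm (ballot n 0) (suc n)) times-suc-n) ⟩
    ((n * 2) C n) / suc n   ≡⟨ cong (λ N → (N C n) / suc n) (*-comm n 2) ⟩
    catalan n               ∎
  where
  open ≡-Reasoning
  c = (n * 2) C n
  times-suc-n : suc n * ballot n 0 ≡ c
  times-suc-n = +-cancelʳ-≡ (n * c) _ _ (begin
      suc n * ballot n 0 + n * c                         ≡⟨ cong (suc n * ballot n 0 +_) (choosePrev-central-ratio n) ⟨
      suc n * ballot n 0 + suc n * choosePrev (n * 2) n ≡⟨ *-distribˡ-+ (suc n) (ballot n 0) (choosePrev (n * 2) n) ⟨
      suc n * (ballot n 0 + choosePrev (n * 2) n)       ≡⟨ cong (suc n *_) (ballot-difference n 0) ⟩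
      suc n * c                                         ∎)

stackSortable-hasCard : ∀ n → HasCard (λ ρ → out (p21 ∷ []) ρ ≡ idPerm n) (catalan n)
stackSortable-hasCard n =
    inputsReaching n [] []
  , inputsReaching-unique n [] [] []
  , (λ ρ → mk⇔ sound (complete ρ))
  , trans (length-inputsReaching n [] []) (ballot≡catalan n)
  where
  sound : ∀ {ρ} → ρ ∈ inputsReaching n [] [] → run₂₁ ρ [] ≡ idPerm n
  sound ρ∈ = trans (inputsReaching-sound n [] [] ρ∈ [] [] []) (trans (++-identityʳ (range 1 n)) (sym (idPerm≡range n)))
  complete : ∀ ρ → run₂₁ ρ [] ≡ idPerm n → ρ ∈ inputsReaching n [] []
  complete ρ sorts = inputsReaching-complete ρ [] 0 n (trans sorts (idPerm≡range n)) (here refl)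

HasCard-bijection : ∀ {P Q : List ℕ → Set} {c} (f g : List ℕ → List ℕ) →
                    (∀ x → g (f x) ≡ x) → (∀ y → f (g y) ≡ y) → (∀ x → P x ⇔ Q (f x)) →
                    HasCard Q c → HasCard P c
HasCard-bijection {P} {Q} f g gf fg P⇔Qf (L , L-unique , ∈L⇔Q , |L|≡c) =
    map g L
  , map⁺ g-injective L-unique
  , (λ x → mk⇔ (to-P x) (from-P x))
  , trans (length-map g L) |L|≡c
  where
  g-injective : ∀ {y y′} → g y ≡ g y′ → y ≡ y′
  g-injective {y} {y′} eq = trans (sym (fg y)) (trans (cong f eq) (fg y′))
  to-P : ∀ x → x ∈ map g L → P x
  to-P x x∈ with ∈-map⁻ g x∈
  ... | y , y∈L , refl = from (P⇔Qf (g y)) (subst Q (sym (fg y)) (to (∈L⇔Q y) y∈L))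
  from-P : ∀ x → P x → x ∈ map g L
  from-P x Px = subst (_∈ map g L) (gf x) (∈-map⁺ g (from (∈L⇔Q (f x)) (to (P⇔Qf x) Px)))

sortable⇔ : ∀ T n π → Sortable T n π ⇔ out (p21 ∷ []) (out T π) ≡ idPerm n
sortable⇔ T n π = mk⇔ proj₂ (λ sorts → perm sorts , sorts)
  where
  perm : out (p21 ∷ []) (out T π) ≡ idPerm n → IsPerm n π
  perm sorts = ↭-trans (↭-sym (↭-trans (out-↭ (p21 ∷ []) (out T π)) (out-↭ T π))) (↭-reflexive sorts)

withSwap-sortable-catalan : ∀ a b r n → HasCard (Sortable (withSwap (a ∷ b ∷ r)) n) (catalan n)
withSwap-sortable-catalan a b r n =
  HasCard-bijection (out (withSwap (a ∷ b ∷ r))) out⁻¹ out⁻¹-out out-out⁻¹ (sortable⇔ _ n) (stackSortable-hasCard n)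
  where open WithSwap a b r

mainTheorem5 :
    ((k : ℕ) → (σ : List ℕ) → 2 ≤ k → IsPerm k σ → (n : ℕ) →
      ((π : List ℕ) → IsPerm n π → IsPerm n (out (σ ∷ swap12 σ ∷ []) π))
      × ((π π' : List ℕ) → IsPerm n π → IsPerm n π' →
          out (σ ∷ swap12 σ ∷ []) π ≡ out (σ ∷ swap12 σ ∷ []) π' → π ≡ π')
      × ((ρ : List ℕ) → IsPerm n ρ →
          Σ (List ℕ) (λ π → IsPerm n π × out (σ ∷ swap12 σ ∷ []) π ≡ ρ)))
    × ((n : ℕ) →
      HasCard (Sortable (p123 ∷ p213 ∷ []) n) (catalan n)
      × HasCard (Sortable (p132 ∷ p312 ∷ []) n) (catalan n)
      × HasCard (Sortable (p231 ∷ p321 ∷ []) n) (catalan n))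
mainTheorem5 =
    (λ k σ 2≤k σ-perm → out-withSwap-bijective σ (subst (2 ≤_) (sym (length-perm σ-perm)) 2≤k))
  , (λ n → withSwap-sortable-catalan 1 2 (3 ∷ []) n
         , withSwap-sortable-catalan 1 3 (2 ∷ []) n
         , withSwap-sortable-catalan 2 3 (1 ∷ []) n)
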